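{- Failed literal elimination and equivalent literal elimination are sampling-safe. That is, let $\varphi$ be a CNF formula with concrete feature set $\mathcal{C}$ and let $\psi$ (with concrete feature set $\mathcal{C}'$) be obtained from $\varphi$ by failed and equivalent literal elimination. Then for every sample $S_\varphi$ of $\varphi$ with pairwise coverage there is a sample $S_\psi$ of $\psi$ with pairwise coverage and $|S_\psi|=|S_\varphi|$, and for every sample $S_\psi$ of $\psi$ with pairwise coverage there is a sample $S_\varphi$ of $\varphi$ with pairwise coverage and $|S_\varphi|=|S_\psi|$.
   Context: A CNF formula $\varphi$ over Boolean features $\mathcal{F}$ with concrete features $\mathcal{C}\subseteq\mathcal{F}$. Configurations are satisfying assignments, viewed as sets of literals. A pairwise interaction is a set of 2 literals of concrete features; it is feasible if contained in some satisfying assignment. A sample (set of satisfying assignments) has pairwise coverage if it covers (contains as subset of a member) every feasible pairwise interaction; additionally, by convention, if the formula is satisfiable the sample must contain at least one configuration, and if there is exactly one concrete feature $x$ and both $x$ and $\overline{x}$ occur in satisfying assignments, the sample must contain a configuration with $x$ and one with $\overline{x}$. Unit propagation: for a partial assignment $Q$ (a set of literals with no complementary pair), repeatedly add the remaining literal of any clause in which all but one literal are false under $Q$ and the remaining one is unassigned, until none remain or some clause has all literals false; $\mathrm{UP}(Q)$ is the result, or $\bot$ in the latter (conflict) case. Failed literal elimination: a literal $\ell$ is failed if $\mathrm{UP}(\{\ell\})=\bot$, or if for some literal $\ell'$ both $\overline{\ell}\in\mathrm{UP}(\{\ell'\})$ and $\overline{\ell}\in\mathrm{UP}(\{\overline{\ell'}\})$;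 it is eliminated by fixing $\ell$ to false, removing clauses this satisfies and removing $\ell$ from the remaining clauses. Equivalent literal elimination: in the directed graph on literals with an arc $(\ell_1,\ell_2)$ whenever $\ell_2\in\mathrm{UP}(\{\ell_1\})$, each strongly connected component is a set of equivalent literals; all variables of a component are replaced by a single representative variable (rewriting clauses accordingly), and the representative is concrete if any replaced variable is concrete. -}

module Defs where

open import Data.Nat using (ℕ; suc)
open import Data.Fin using (Fin; punchIn)
import Data.Fin.Properties as FinP
open import Data.Bool using (Bool; true; false; T)
open import Data.Vec using (Vec; lookup)
open import Data.List using (List; []; _∷_; [_]; map; filter; length)
open import Data.List.Relation.Unary.All using (All)
open import Data.List.Relation.Unary.Any using (Any; any?)
open import Data.List.Membership.Propositional using (_∈_; _∉_)
open import Data.List.Relation.Unary.Unique.Propositional using (Unique)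
open import Data.Product using (Σ; ∃; _×_; _,_)
open import Data.Sum using (_⊎_)
open import Relation.Nullary using (¬_; Dec; yes; no; ¬?)
open import Relation.Binary.PropositionalEquality using (_≡_; _≢_; refl; cong)
open import Relation.Binary.Construct.Closure.ReflexiveTransitive using (Star)

data Lit (n : ℕ) : Set where
  pos : Fin n → Lit n
  neg : Fin n → Lit n

var : ∀ {n} → Lit n → Fin n
var (pos v) = v
var (neg v) = v

negate : ∀ {n} → Lit n → Lit n
negate (pos v) = neg v
negate (neg v) = pos v

mapLit : ∀ {n m} → (Fin n → Fin m) → Lit n → Lit m
mapLit f (pos v) = pos (f v)
mapLit f (neg v) = neg (f v)

_≟L_ : ∀ {n} (a b : Lit n) → Dec (a ≡ b)
pos u ≟L pos v with u FinP.≟ v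
... | yes refl = yes refl
... | no u≢v = no λ { refl → u≢v refl }
pos u ≟L neg v = no λ ()
neg u ≟L pos v = no λ ()
neg u ≟L neg v with u FinP.≟ v
... | yes refl = yes refl
... | no u≢v = no λ { refl → u≢v refl }

Clause : ℕ → Set
Clause n = List (Lit n)

record Formula (n : ℕ) : Set where
  constructor mkFormula
  field
    clauses  : List (Clause n)
    concrete : Fin n → Bool
open Formula public

Assignment : ℕ → Set
Assignment n = Vec Bool n

-- literal ℓ belongs to the configuration α (viewed as a set of literals)
_⊨_ : ∀ {n} → Assignment n → Lit n → Set
α ⊨ pos v = lookup α v ≡ true
α ⊨ neg v = lookup α v ≡ false

Satisfies : ∀ {n} → Formula n → Assignment n → Set
Satisfies φ α = All (Any (α ⊨_)) (clauses φ)

Satisfiable : ∀ {n} → Formula n → Set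
Satisfiable φ = ∃ λ α → Satisfies φ α

PartialAssignment : ℕ → Set
PartialAssignment n = List (Lit n)

module _ {n : ℕ} (φ : Formula n) where

  FalseUnder : PartialAssignment n → Lit n → Set
  FalseUnder Q ℓ = negate ℓ ∈ Q

  Unassigned : PartialAssignment n → Lit n → Set
  Unassigned Q ℓ = ℓ ∉ Q × negate ℓ ∉ Q

  Conflicting : PartialAssignment n → Set
  Conflicting Q = Any (All (FalseUnder Q)) (clauses φ)

  data UPStep (Q : PartialAssignment n) : PartialAssignment n → Set where
    unit : ∀ {c ℓ} → c ∈ clauses φ → ℓ ∈ c → ¬ Conflicting Q → Unassigned Q ℓ →
           All (λ ℓ' → ℓ' ≡ ℓ ⊎ FalseUnder Q ℓ') c → UPStep Q (ℓ ∷ Q)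

  UPConflict : PartialAssignment n → Set
  UPConflict Q = ∃ λ R → Star UPStep Q R × Conflicting R

  -- ℓ ∈ UP(Q)  (UP(Q) ≠ ⊥ and ℓ in the final partial assignment)
  InUP : PartialAssignment n → Lit n → Set
  InUP Q ℓ = ∃ λ R → Star UPStep Q R × ¬ Conflicting R ×
                     (∀ R' → ¬ UPStep R R') × ℓ ∈ R

  Failed : Lit n → Set
  Failed ℓ = UPConflict [ ℓ ]
           ⊎ ∃ λ ℓ' → InUP [ ℓ' ] (negate ℓ) × InUP [ negate ℓ' ] (negate ℓ)

  Arc : Lit n → Lit n → Set
  Arc ℓ₁ ℓ₂ = InUP [ ℓ₁ ] ℓ₂

  SameSCC : Lit n → Lit n → Set
  SameSCC ℓ₁ ℓ₂ = Star Arc ℓ₁ ℓ₂ × Star Arc ℓ₂ ℓ₁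

-- The failed literal ℓ is fixed
-- to false: clauses containing ¬ℓ are removed, ℓ is removed from the
-- remaining clauses, and the (now fixed) feature var ℓ is removed from the
-- feature set; the remaining features are renumbered via punchIn (var ℓ).

removeLit : ∀ {n} → Lit n → Clause n → Clause n
removeLit ℓ = filter (λ ℓ' → ¬? (ℓ' ≟L ℓ))

record FailedLitElim {n : ℕ} (φ : Formula (suc n)) (ψ : Formula n) : Set where
  field
    lit        : Lit (suc n)
    failed     : Failed φ lit
    clauses-eq : map (map (mapLit (punchIn (var lit)))) (clauses ψ)
                 ≡ map (removeLit lit)
                       (filter (λ c → ¬? (any? (_≟L_ (negate lit)) c)) (clauses φ))
    concrete-eq : ∀ j → concrete ψ j ≡ concrete φ (punchIn (var lit) j)

-- Equivalent literal elimination (one step, all components at once).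
-- σ v is the literal (over the new features) replacing old feature v;
-- ι j is the old feature that is the representative of new feature j.

substLit : ∀ {n m} → (Fin n → Lit m) → Lit n → Lit m
substLit σ (pos v) = σ v
substLit σ (neg v) = negate (σ v)

record EquivLitElim {n m : ℕ} (φ : Formula n) (ψ : Formula m) : Set where
  field
    σ : Fin n → Lit m
    ι : Fin m → Fin n
    rep-eq      : ∀ j → σ (ι j) ≡ pos j
    rep-scc     : ∀ v → SameSCC φ (pos v) (mapLit ι (σ v))
    scc-merged  : ∀ ℓ₁ ℓ₂ → SameSCC φ ℓ₁ ℓ₂ → substLit σ ℓ₁ ≡ substLit σ ℓ₂
    clauses-eq  : clauses ψ ≡ map (map (substLit σ)) (clauses φ)
    concrete-to   : ∀ j → T (concrete ψ j) → ∃ λ v → var (σ v) ≡ j × T (concrete φ v)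
    concrete-from : ∀ j v → var (σ v) ≡ j → T (concrete φ v) → T (concrete ψ j)

data _⇝*_ : ∀ {n m} → Formula n → Formula m → Set where
  done : ∀ {n} {φ : Formula n} → φ ⇝* φ
  fle  : ∀ {n m} {φ : Formula (suc n)} {ψ : Formula n} {χ : Formula m} →
         FailedLitElim φ ψ → ψ ⇝* χ → φ ⇝* χ
  ele  : ∀ {n k m} {φ : Formula n} {ψ : Formula k} {χ : Formula m} →
         EquivLitElim φ ψ → ψ ⇝* χ → φ ⇝* χ

-- a sample: a set (duplicate-free list) of satisfying assignments;
-- its size |S| is the length of the list
IsSample : ∀ {n} → Formula n → List (Assignment n) → Set
IsSample φ S = All (Satisfies φ) S × Unique S

ConcreteLit : ∀ {n} → Formula n → Lit n → Set
ConcreteLit φ ℓ = T (concrete φ (var ℓ))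

FeasiblePair : ∀ {n} → Formula n → Lit n → Lit n → Set
FeasiblePair φ ℓ₁ ℓ₂ = ∃ λ α → Satisfies φ α × α ⊨ ℓ₁ × α ⊨ ℓ₂

CoversPair : ∀ {n} → List (Assignment n) → Lit n → Lit n → Set
CoversPair S ℓ₁ ℓ₂ = Any (λ α → α ⊨ ℓ₁ × α ⊨ ℓ₂) S

FeasibleLit : ∀ {n} → Formula n → Lit n → Set
FeasibleLit φ ℓ = ∃ λ α → Satisfies φ α × α ⊨ ℓ

CoversLit : ∀ {n} → List (Assignment n) → Lit n → Set
CoversLit S ℓ = Any (_⊨ ℓ) S

OnlyConcrete : ∀ {n} → Formula n → Fin n → Set
OnlyConcrete φ x = T (concrete φ x) × (∀ y → T (concrete φ y) → y ≡ x)

PairwiseCoverage : ∀ {n} → Formula n → List (Assignment n) → Set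
PairwiseCoverage φ S =
    (∀ ℓ₁ ℓ₂ → ConcreteLit φ ℓ₁ → ConcreteLit φ ℓ₂ → ℓ₁ ≢ ℓ₂ →
       FeasiblePair φ ℓ₁ ℓ₂ → CoversPair S ℓ₁ ℓ₂)
  × (Satisfiable φ → S ≢ [])
  × (∀ x → OnlyConcrete φ x → FeasibleLit φ (pos x) → FeasibleLit φ (neg x) →
       CoversLit S (pos x) × CoversLit S (neg x))

PairwiseSample : ∀ {n} → Formula n → List (Assignment n) → Set
PairwiseSample φ S = IsSample φ S × PairwiseCoverage φ S

{-# OPTIONS --safe #-}
-- Unit propagation is sound: whatever it derives from ℓ holds in every model
-- satisfying ℓ. Hence a failed literal is false in every model, and the literals
-- of a strongly connected component agree in every model. Each elimination step
-- therefore induces a bijection between the models of φ and of ψ (drop the fixed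
-- feature, resp. restrict to the representatives) under which every feasible
-- concrete literal of either formula is, on models, forced true or equivalent to
-- a concrete literal of the other. Mapping a sample through this bijection keeps
-- it duplicate-free and of the same size, and a feasible pair of concrete literals
-- on one side pulls back to a feasible conjunction of at most two concrete
-- literals on the other, which a pairwise sample covers; for a single literal this
-- needs a second concrete feature, or the convention for a unique concrete one.

module Submission where

open import Defs
open import Data.Nat using (ℕ; suc)
open import Data.Fin using (Fin; punchIn; punchOut)
import Data.Fin.Properties as FinP
open import Data.Bool using (Bool; true; false; T; not)
open import Data.Bool.Properties using (T?; not-involutive)
open import Data.Vec using (lookup; tabulate; insertAt; removeAt)
import Data.Vec.Properties as VecP
open import Data.List using (List; []; _∷_; [_]; map; filter; length)
open import Data.List.Properties using (length-map)
open import Data.List.Relation.Unary.All as All using (All; []; _∷_; lookupAny)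
import Data.List.Relation.Unary.All.Properties as AllP
open import Data.List.Relation.Unary.Any as Any using (Any; here; there; any?)
import Data.List.Relation.Unary.Any.Properties as AnyP
open import Data.List.Relation.Unary.Unique.Propositional using (Unique; []; _∷_)
open import Data.List.Membership.Propositional using (find; lose)
open import Data.List.Membership.Propositional.Properties using (∈-map⁺)
open import Data.Maybe using (Maybe; just; nothing)
open import Data.Maybe.Relation.Unary.All as Maybe using (just; nothing)
open import Data.Product using (∃; _×_; _,_; proj₁; proj₂)
open import Data.Sum using (_⊎_; inj₁; inj₂; [_,_]′)
open import Data.Empty using (⊥-elim)
open import Function using (id; _∘_)
open import Function.Bundles using (_⇔_; mk⇔; Equivalence)
open import Relation.Nullary using (¬_; yes; no; ¬?; contradiction)
open import Relation.Nullary.Decidable using (_×-dec_; decidable-stable)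
open import Relation.Binary.PropositionalEquality
  using (_≡_; _≢_; refl; sym; trans; cong; subst; module ≡-Reasoning)
open import Relation.Binary.Construct.Closure.ReflexiveTransitive using (Star; ε; _◅_)

private variable
  n a b : ℕ
  α β : Assignment n
  l k : Lit n

val : Assignment n → Lit n → Bool
val α (pos v) = lookup α v
val α (neg v) = not (lookup α v)

⊨⇒val : ∀ l → α ⊨ l → val α l ≡ true
⊨⇒val (pos v) p = p
⊨⇒val (neg v) p = cong not p

val⇒⊨ : ∀ l → val α l ≡ true → α ⊨ l
val⇒⊨ (pos v) e = e
val⇒⊨ (neg v) e = trans (sym (not-involutive _)) (cong not e)

⊨-transport : ∀ l k → val α l ≡ val β k → α ⊨ l → β ⊨ k
⊨-transport l k e p = val⇒⊨ k (trans (sym e) (⊨⇒val l p))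

⇔⇒val-≡ : ∀ l k → α ⊨ l ⇔ β ⊨ k → val α l ≡ val β k
⇔⇒val-≡ {α = α} {β = β} l k l⇔k with val α l in el | val β k in ek
... | true  | true  = refl
... | false | false = refl
... | true  | false = sym (trans (sym ek) (⊨⇒val k (Equivalence.to l⇔k (val⇒⊨ l el))))
... | false | true  = trans (sym el) (⊨⇒val l (Equivalence.from l⇔k (val⇒⊨ k ek)))

val-negate : ∀ (α : Assignment n) l → val α (negate l) ≡ not (val α l)
val-negate α (pos v) = refl
val-negate α (neg v) = sym (not-involutive _)

⊨-excl : ∀ l → α ⊨ l → ¬ α ⊨ negate l
⊨-excl (pos v) p q with () ← trans (sym p) q
⊨-excl (neg v) p q with () ← trans (sym q) p

⊨-dec : ∀ (α : Assignment n) l → α ⊨ l ⊎ α ⊨ negate l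
⊨-dec α (pos v) with lookup α v
... | true  = inj₁ refl
... | false = inj₂ refl
⊨-dec α (neg v) with lookup α v
... | true  = inj₂ refl
... | false = inj₁ refl

≡⊎≡negate : ∀ (k l : Lit n) → var k ≡ var l → k ≡ l ⊎ k ≡ negate l
≡⊎≡negate (pos v) (pos .v) refl = inj₁ refl
≡⊎≡negate (pos v) (neg .v) refl = inj₂ refl
≡⊎≡negate (neg v) (pos .v) refl = inj₂ refl
≡⊎≡negate (neg v) (neg .v) refl = inj₁ refl

val-mapLit : ∀ {f : Fin n → Fin b} {α : Assignment n} {β : Assignment b} →
  (∀ v → lookup β (f v) ≡ lookup α v) → ∀ l → val β (mapLit f l) ≡ val α l
val-mapLit e (pos v) = e v
val-mapLit e (neg v) = cong not (e v)

val-substLit : ∀ {σ : Fin n → Lit b} {α : Assignment n} {β : Assignment b} →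
  (∀ v → val β (σ v) ≡ lookup α v) → ∀ l → val β (substLit σ l) ≡ val α l
val-substLit e (pos v) = e v
val-substLit {σ = σ} {β = β} e (neg v) = trans (val-negate β (σ v)) (cong not (e v))

var-substLit : ∀ (σ : Fin n → Lit b) l → var (σ (var l)) ≡ var (substLit σ l)
var-substLit σ (pos v) = refl
var-substLit σ (neg v) with σ v
... | pos _ = refl
... | neg _ = refl

satisfies-map : ∀ {τ : Lit n → Lit b} {α : Assignment n} {β : Assignment b} →
  (∀ l → val β (τ l) ≡ val α l) →
  ∀ cs → All (Any (α ⊨_)) cs ⇔ All (Any (β ⊨_)) (map (map τ) cs)
satisfies-map {τ = τ} e cs = mk⇔
  (AllP.map⁺ ∘ All.map (AnyP.map⁺ ∘ Any.map (λ {l} → ⊨-transport l (τ l) (sym (e l)))))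
  (All.map (Any.map (λ {l} → ⊨-transport (τ l) l (e l)) ∘ AnyP.map⁻) ∘ AllP.map⁻)

assignFalse : Lit n → List (Clause n) → List (Clause n)
assignFalse ℓ cs = map (removeLit ℓ) (filter (λ c → ¬? (any? (_≟L_ (negate ℓ)) c)) cs)

removeLit-sound : ∀ ℓ → α ⊨ negate ℓ → ∀ c → Any (α ⊨_) c → Any (α ⊨_) (removeLit ℓ c)
removeLit-sound ℓ ℓ-false (l ∷ c) (here p) with l ≟L ℓ
... | yes refl = contradiction ℓ-false (⊨-excl ℓ p)
... | no _     = here p
removeLit-sound ℓ ℓ-false (l ∷ c) (there p) with l ≟L ℓ
... | yes _ = removeLit-sound ℓ ℓ-false c p
... | no _  = there (removeLit-sound ℓ ℓ-false c p)

satisfies-assignFalse : ∀ ℓ → α ⊨ negate ℓ →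
  ∀ cs → All (Any (α ⊨_)) cs ⇔ All (Any (α ⊨_)) (assignFalse ℓ cs)
satisfies-assignFalse ℓ ℓ-false cs = mk⇔
  (AllP.map⁺ ∘ All.map (removeLit-sound ℓ ℓ-false _) ∘ AllP.filter⁺ _)
  (λ sat → AllP.filter⁻ contains-negate
     (All.map (Any.map λ { refl → ℓ-false }) (AllP.all-filter contains-negate cs))
     (All.map (AnyP.filter⁻ _) (AllP.map⁻ sat)))
  where contains-negate = any? (_≟L_ (negate ℓ))

module _ {φ : Formula n} {α : Assignment n} (sat : Satisfies φ α) where

  ¬Conflicting : ∀ {Q} → All (α ⊨_) Q → ¬ Conflicting φ Q
  ¬Conflicting α⊨Q conflict =
    let c-true , c-false = lookupAny sat conflict
        l-false , l-true = lookupAny c-false c-true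
    in ⊨-excl _ l-true (All.lookup α⊨Q l-false)

  UPStep-sound : ∀ {Q R} → UPStep φ Q R → All (α ⊨_) Q → All (α ⊨_) R
  UPStep-sound (unit c∈φ _ _ _ rest) α⊨Q with lookupAny rest (All.lookup sat c∈φ)
  ... | inj₁ refl , l-true = l-true ∷ α⊨Q
  ... | inj₂ l-false , l-true = ⊥-elim (⊨-excl _ l-true (All.lookup α⊨Q l-false))

  propagation-sound : ∀ {Q R} → Star (UPStep φ) Q R → All (α ⊨_) Q → All (α ⊨_) R
  propagation-sound ε α⊨Q = α⊨Q
  propagation-sound (s ◅ ss) α⊨Q = propagation-sound ss (UPStep-sound s α⊨Q)

  UPConflict-sound : UPConflict φ [ l ] → ¬ α ⊨ l
  UPConflict-sound (_ , ss , conflict) p = ¬Conflicting (propagation-sound ss (p ∷ [])) conflict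

  InUP-sound : InUP φ [ l ] k → α ⊨ l → α ⊨ k
  InUP-sound (_ , ss , _ , _ , k∈R) p = All.lookup (propagation-sound ss (p ∷ [])) k∈R

  Failed-sound : Failed φ l → α ⊨ negate l
  Failed-sound {l = l} (inj₁ conflict) with ⊨-dec α l
  ... | inj₁ p = contradiction p (UPConflict-sound conflict)
  ... | inj₂ q = q
  Failed-sound (inj₂ (l' , from-l' , from-¬l')) with ⊨-dec α l'
  ... | inj₁ p = InUP-sound from-l' p
  ... | inj₂ q = InUP-sound from-¬l' q

  Arc*-sound : Star (Arc φ) l k → α ⊨ l → α ⊨ k
  Arc*-sound ε p = p
  Arc*-sound (arc ◅ arcs) p = Arc*-sound arcs (InUP-sound arc p)

  SameSCC-sound : SameSCC φ l k → val α l ≡ val α k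
  SameSCC-sound (l↝k , k↝l) = ⇔⇒val-≡ _ _ (mk⇔ (Arc*-sound l↝k) (Arc*-sound k↝l))

_⊨ₘ_ : Assignment n → Maybe (Lit n) → Set
α ⊨ₘ m = Maybe.All (α ⊨_) m

module _ {A : Formula n} where

  coversLit⊎negateFeasible : ∀ {S} → All (Satisfies A) S → S ≢ [] →
    CoversLit S l ⊎ FeasibleLit A (negate l)
  coversLit⊎negateFeasible {S = []} _ S≢[] = contradiction refl S≢[]
  coversLit⊎negateFeasible {l = l} {S = α ∷ _} (sα ∷ _) _ with ⊨-dec α l
  ... | inj₁ p = inj₁ (here p)
  ... | inj₂ q = inj₂ (α , sα , q)

  coversFeasibleLit : ∀ {S} → PairwiseSample A S → ConcreteLit A l → FeasibleLit A l → CoversLit S l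
  coversFeasibleLit {l = l} {S} ((models , _) , pairs , nonempty , only) cl (α , sα , p)
    with FinP.any? (λ y → T? (concrete A y) ×-dec ¬? (y FinP.≟ var l))
  ... | yes (y , cy , y≢l) = [ pairedWith (pos y) refl , pairedWith (neg y) refl ]′ (⊨-dec α (pos y))
    where
    pairedWith : ∀ l' → var l' ≡ y → α ⊨ l' → CoversLit S l
    pairedWith l' refl q =
      Any.map proj₁ (pairs l l' cl cy (λ l≡l' → y≢l (cong var (sym l≡l'))) (α , sα , p , q))
  ... | no none = [ id , coversByOnlyConcrete l onlyConcrete (α , sα , p) ]′
                      (coversLit⊎negateFeasible models (nonempty (α , sα)))
    where
    onlyConcrete : OnlyConcrete A (var l)
    onlyConcrete = cl , λ y cy → decidable-stable (y FinP.≟ var l) (λ y≢l → none (y , cy , y≢l))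
    coversByOnlyConcrete : ∀ l → OnlyConcrete A (var l) →
      FeasibleLit A l → FeasibleLit A (negate l) → CoversLit S l
    coversByOnlyConcrete (pos x) oc f f̄ = proj₁ (only x oc f f̄)
    coversByOnlyConcrete (neg x) oc f f̄ = proj₂ (only x oc f̄ f)

  coversFeasiblePair : ∀ {S l₁ l₂} → PairwiseSample A S → ConcreteLit A l₁ → ConcreteLit A l₂ →
    FeasiblePair A l₁ l₂ → CoversPair S l₁ l₂
  coversFeasiblePair {l₁ = l₁} {l₂} ps@(_ , pairs , _) c₁ c₂ (α , sα , p₁ , p₂) with l₁ ≟L l₂
  ... | yes refl = Any.map (λ p → p , p) (coversFeasibleLit ps c₁ (α , sα , p₁))
  ... | no l₁≢l₂ = pairs l₁ l₂ c₁ c₂ l₁≢l₂ (α , sα , p₁ , p₂)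

  coversOptionalPair : ∀ {S} → PairwiseSample A S → ∀ {m₁ m₂} →
    Maybe.All (ConcreteLit A) m₁ → Maybe.All (ConcreteLit A) m₂ →
    (∃ λ α → Satisfies A α × α ⊨ₘ m₁ × α ⊨ₘ m₂) → Any (λ α → α ⊨ₘ m₁ × α ⊨ₘ m₂) S
  coversOptionalPair ps (just c₁) (just c₂) (α , sα , just p₁ , just p₂) =
    Any.map (λ (q₁ , q₂) → just q₁ , just q₂) (coversFeasiblePair ps c₁ c₂ (α , sα , p₁ , p₂))
  coversOptionalPair ps (just c₁) nothing (α , sα , just p₁ , _) =
    Any.map (λ q₁ → just q₁ , nothing) (coversFeasibleLit ps c₁ (α , sα , p₁))
  coversOptionalPair ps nothing (just c₂) (α , sα , _ , just p₂) =
    Any.map (λ q₂ → nothing , just q₂) (coversFeasibleLit ps c₂ (α , sα , p₂))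
  coversOptionalPair {S = S} (_ , _ , nonempty , _) nothing nothing (α , sα , _) =
    nonemptyCovers S (nonempty (α , sα))
    where
    nonemptyCovers : ∀ S → S ≢ [] → Any (λ α → α ⊨ₘ nothing × α ⊨ₘ nothing) S
    nonemptyCovers [] S≢[] = contradiction refl S≢[]
    nonemptyCovers (_ ∷ _) _ = here (nothing , nothing)

record ModelBijection (A : Formula a) (B : Formula b) : Set where
  field
    to       : Assignment a → Assignment b
    from     : Assignment b → Assignment a
    to-sat   : Satisfies A α → Satisfies B (to α)
    from-sat : Satisfies B β → Satisfies A (from β)
    to∘from  : Satisfies B β → to (from β) ≡ β
    from∘to  : Satisfies A α → from (to α) ≡ α

ModelBijection-sym : ∀ {A : Formula a} {B : Formula b} → ModelBijection A B → ModelBijection B A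
ModelBijection-sym f = record
  { to = from ; from = to
  ; to-sat = from-sat ; from-sat = to-sat
  ; to∘from = from∘to ; from∘to = to∘from
  }
  where open ModelBijection f

-- source = nothing encodes that k holds at h α for every model α of A.
record Trace (A : Formula a) (h : Assignment a → Assignment b) (k : Lit b) : Set where
  field
    source          : Maybe (Lit a)
    source-concrete : Maybe.All (ConcreteLit A) source
    sound           : Satisfies A α → α ⊨ₘ source → h α ⊨ k
    complete        : Satisfies A α → h α ⊨ k → α ⊨ₘ source
open Trace

literalTrace : ∀ {A : Formula a} {h : Assignment a → Assignment b} →
  ∀ l → ConcreteLit A l → (∀ {α} → Satisfies A α → val (h α) k ≡ val α l) → Trace A h k
literalTrace {k = k} l cl e = record
  { source = just l
  ; source-concrete = just cl
  ; sound = λ { sα (just p) → ⊨-transport l k (sym (e sα)) p }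
  ; complete = λ sα p → just (⊨-transport k l (e sα) p)
  }

forcedTrace : ∀ {A : Formula a} {h : Assignment a → Assignment b} →
  (∀ {α} → Satisfies A α → h α ⊨ k) → Trace A h k
forcedTrace forced = record
  { source = nothing
  ; source-concrete = nothing
  ; sound = λ sα _ → forced sα
  ; complete = λ _ _ → nothing
  }

Traceable : ∀ {A : Formula a} {B : Formula b} → ModelBijection A B → Set
Traceable {A = A} {B = B} f =
  ∀ k → ConcreteLit B k → FeasibleLit B k → Trace A (ModelBijection.to f) k

SampleTransfer : Formula a → Formula b → Set
SampleTransfer {a} {b} A B = (S : List (Assignment a)) → PairwiseSample A S →
  ∃ λ (S' : List (Assignment b)) → PairwiseSample B S' × length S' ≡ length S

Unique-map-on : ∀ {A B : Set} {P : A → Set} {f : A → B} →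
  (∀ {x y} → P x → P y → f x ≡ f y → x ≡ y) →
  ∀ {xs} → All P xs → Unique xs → Unique (map f xs)
Unique-map-on inj [] [] = []
Unique-map-on inj (px ∷ pxs) (x∉xs ∷ u) =
  AllP.map⁺ (All.zipWith (λ (py , x≢y) → x≢y ∘ inj px py) (pxs , x∉xs)) ∷ Unique-map-on inj pxs u

map-≢[] : ∀ {A B : Set} {f : A → B} {xs} → xs ≢ [] → map f xs ≢ []
map-≢[] {xs = []} xs≢[] = contradiction refl xs≢[]
map-≢[] {xs = _ ∷ _} _ ()

module _ {A : Formula a} {B : Formula b} (f : ModelBijection A B) (trace : Traceable f) where
  open ModelBijection f

  coversTracedPair : ∀ {S k₁ k₂} → PairwiseSample A S → Trace A to k₁ → Trace A to k₂ →
    FeasiblePair B k₁ k₂ → CoversPair (map to S) k₁ k₂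
  coversTracedPair ps@((models , _) , _) t₁ t₂ (β , sβ , p₁ , p₂) =
    let α , α∈S , q₁ , q₂ = find (coversOptionalPair ps (source-concrete t₁) (source-concrete t₂)
                                    (from β , from-sat sβ , pulledBack t₁ p₁ , pulledBack t₂ p₂))
        sα = All.lookup models α∈S
    in lose (∈-map⁺ to α∈S) (sound t₁ sα q₁ , sound t₂ sα q₂)
    where
    pulledBack : ∀ {k} (t : Trace A to k) → β ⊨ k → from β ⊨ₘ source t
    pulledBack {k} t p = complete t (from-sat sβ) (subst (_⊨ k) (sym (to∘from sβ)) p)

  coversTracedLit : ∀ {S} → PairwiseSample A S → ∀ k → ConcreteLit B k → FeasibleLit B k →
    CoversLit (map to S) k
  coversTracedLit ps k ck fk@(β , sβ , p) =
    Any.map proj₁ (coversTracedPair ps (trace k ck fk) (trace k ck fk) (β , sβ , p , p))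

  transfer : SampleTransfer A B
  transfer S ps@((models , unique) , _ , nonempty , _) =
    map to S , sample , length-map to S
    where
    sample : PairwiseSample B (map to S)
    sample =
      ( AllP.map⁺ (All.map to-sat models)
      , Unique-map-on (λ sx sy e → trans (sym (from∘to sx)) (trans (cong from e) (from∘to sy)))
                      models unique )
      , (λ k₁ k₂ c₁ c₂ _ fp@(β , sβ , p₁ , p₂) →
           coversTracedPair ps (trace k₁ c₁ (β , sβ , p₁)) (trace k₂ c₂ (β , sβ , p₂)) fp)
      , (λ (β , sβ) → map-≢[] (nonempty (from β , from-sat sβ)))
      , (λ x (cx , _) f f̄ → coversTracedLit ps (pos x) cx f , coversTracedLit ps (neg x) cx f̄)

SamplingSafe : Formula a → Formula b → Set
SamplingSafe A B = SampleTransfer A B × SampleTransfer B A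

SamplingSafe-refl : ∀ {A : Formula a} → SamplingSafe A A
SamplingSafe-refl = (λ S ps → S , ps , refl) , (λ S ps → S , ps , refl)

SampleTransfer-trans : ∀ {c} {A : Formula a} {B : Formula b} {C : Formula c} →
  SampleTransfer A B → SampleTransfer B C → SampleTransfer A C
SampleTransfer-trans AB BC S ps =
  let S' , ps' , |S'| = AB S ps
      S'' , ps'' , |S''| = BC S' ps'
  in S'' , ps'' , trans |S''| |S'|

SamplingSafe-trans : ∀ {c} {A : Formula a} {B : Formula b} {C : Formula c} →
  SamplingSafe A B → SamplingSafe B C → SamplingSafe A C
SamplingSafe-trans (AB , BA) (BC , CB) = SampleTransfer-trans AB BC , SampleTransfer-trans CB BA

ModelBijection⇒SamplingSafe : ∀ {A : Formula a} {B : Formula b} (f : ModelBijection A B) →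
  Traceable f → Traceable (ModelBijection-sym f) → SamplingSafe A B
ModelBijection⇒SamplingSafe f trace trace⁻¹ =
  transfer f trace , transfer (ModelBijection-sym f) trace⁻¹

falsifier : Lit n → Bool
falsifier (pos _) = false
falsifier (neg _) = true

⊨negate⇔falsifier : ∀ l → α ⊨ negate l ⇔ lookup α (var l) ≡ falsifier l
⊨negate⇔falsifier (pos v) = mk⇔ id id
⊨negate⇔falsifier (neg v) = mk⇔ id id

lookup-removeAt : ∀ (α : Assignment (suc n)) i j → lookup (removeAt α i) j ≡ lookup α (punchIn i j)
lookup-removeAt α i j = begin
  lookup (removeAt α i) j
    ≡⟨ VecP.insertAt-punchIn (removeAt α i) i (lookup α i) j ⟨
  lookup (insertAt (removeAt α i) i (lookup α i)) (punchIn i j)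
    ≡⟨ cong (λ γ → lookup γ (punchIn i j)) (VecP.insertAt-removeAt α i) ⟩
  lookup α (punchIn i j)
    ∎
  where open ≡-Reasoning

punchOutLit : ∀ {i : Fin (suc n)} k → var k ≢ i → ∃ λ k' → mapLit (punchIn i) k' ≡ k
punchOutLit (pos v) v≢i = pos (punchOut (v≢i ∘ sym)) , cong pos (FinP.punchIn-punchOut _)
punchOutLit (neg v) v≢i = neg (punchOut (v≢i ∘ sym)) , cong neg (FinP.punchIn-punchOut _)

module _ {φ : Formula (suc n)} {ψ : Formula n} (step : FailedLitElim φ ψ) where
  open FailedLitElim step

  private
    dropFixed : Assignment (suc n) → Assignment n
    dropFixed α = removeAt α (var lit)

    insertFixed : Assignment n → Assignment (suc n)
    insertFixed β = insertAt β (var lit) (falsifier lit)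

    insertFixed-⊨negate : ∀ β → insertFixed β ⊨ negate lit
    insertFixed-⊨negate β =
      Equivalence.from (⊨negate⇔falsifier lit) (VecP.insertAt-lookup β (var lit) _)

    val-dropFixed : ∀ α l → val α (mapLit (punchIn (var lit)) l) ≡ val (dropFixed α) l
    val-dropFixed α = val-mapLit (λ j → sym (lookup-removeAt α (var lit) j))

    val-insertFixed : ∀ β l → val (insertFixed β) (mapLit (punchIn (var lit)) l) ≡ val β l
    val-insertFixed β = val-mapLit (VecP.insertAt-punchIn β (var lit) _)

    ConcreteLit-punchIn : ∀ k → ConcreteLit ψ k ⇔ ConcreteLit φ (mapLit (punchIn (var lit)) k)
    ConcreteLit-punchIn (pos j) = mk⇔ (subst T (concrete-eq j)) (subst T (sym (concrete-eq j)))
    ConcreteLit-punchIn (neg j) = mk⇔ (subst T (concrete-eq j)) (subst T (sym (concrete-eq j)))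

  FailedLitElim-bijection : ModelBijection φ ψ
  FailedLitElim-bijection = record
    { to       = dropFixed
    ; from     = insertFixed
    ; to-sat   = λ {α} sα →
        Equivalence.from (satisfies-map (val-dropFixed α) (clauses ψ))
          (subst (All (Any (α ⊨_))) (sym clauses-eq)
            (Equivalence.to (satisfies-assignFalse lit (Failed-sound sα failed) (clauses φ)) sα))
    ; from-sat = λ {β} sβ →
        Equivalence.from (satisfies-assignFalse lit (insertFixed-⊨negate β) (clauses φ))
          (subst (All (Any (insertFixed β ⊨_))) clauses-eq
            (Equivalence.to (satisfies-map (val-insertFixed β) (clauses ψ)) sβ))
    ; to∘from  = λ {β} _ → VecP.removeAt-insertAt β (var lit) _
    ; from∘to  = λ {α} sα →
        subst (λ x → insertAt (removeAt α (var lit)) (var lit) x ≡ α)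
              (Equivalence.to (⊨negate⇔falsifier lit) (Failed-sound sα failed))
              (VecP.insertAt-removeAt α (var lit))
    }

  FailedLitElim-traceable : Traceable FailedLitElim-bijection
  FailedLitElim-traceable k ck _ =
    literalTrace (mapLit (punchIn (var lit)) k) (Equivalence.to (ConcreteLit-punchIn k) ck)
                 (λ {α} _ → sym (val-dropFixed α k))

  FailedLitElim-traceable⁻¹ : Traceable (ModelBijection-sym FailedLitElim-bijection)
  FailedLitElim-traceable⁻¹ k ck (α , sα , p) with var k FinP.≟ var lit
  ... | no k≢lit with punchOutLit k k≢lit
  ...   | k' , refl =
          literalTrace k' (Equivalence.from (ConcreteLit-punchIn k') ck)
                       (λ {β} _ → val-insertFixed β k')
  FailedLitElim-traceable⁻¹ k ck (α , sα , p) | yes k∼lit with ≡⊎≡negate k lit k∼lit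
  ... | inj₁ refl = contradiction (Failed-sound sα failed) (⊨-excl lit p)
  ... | inj₂ refl = forcedTrace (λ {β} _ → insertFixed-⊨negate β)

  FailedLitElim⇒SamplingSafe : SamplingSafe φ ψ
  FailedLitElim⇒SamplingSafe = ModelBijection⇒SamplingSafe FailedLitElim-bijection
    FailedLitElim-traceable FailedLitElim-traceable⁻¹

module _ {φ : Formula n} {ψ : Formula b} (step : EquivLitElim φ ψ) where
  open EquivLitElim step

  private
    restrict : Assignment n → Assignment b
    restrict α = tabulate (lookup α ∘ ι)

    extend : Assignment b → Assignment n
    extend β = tabulate (val β ∘ σ)

    val-restrict : Satisfies φ α → ∀ l → val (restrict α) (substLit σ l) ≡ val α l
    val-restrict {α = α} sα = val-substLit λ v → begin
      val (restrict α) (σ v)      ≡⟨ val-mapLit (λ j → sym (VecP.lookup∘tabulate _ j)) (σ v) ⟨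
      val α (mapLit ι (σ v))      ≡⟨ SameSCC-sound sα (rep-scc v) ⟨
      lookup α v                  ∎
      where open ≡-Reasoning

    val-extend : ∀ β l → val β (substLit σ l) ≡ val (extend β) l
    val-extend β = val-substLit (λ v → sym (VecP.lookup∘tabulate _ v))

  EquivLitElim-bijection : ModelBijection φ ψ
  EquivLitElim-bijection = record
    { to       = restrict
    ; from     = extend
    ; to-sat   = λ sα →
        subst (All (Any _)) (sym clauses-eq)
          (Equivalence.to (satisfies-map (val-restrict sα) (clauses φ)) sα)
    ; from-sat = λ {β} sβ →
        Equivalence.from (satisfies-map (val-extend β) (clauses φ))
          (subst (All (Any _)) clauses-eq sβ)
    ; to∘from  = λ {β} _ → trans
        (VecP.tabulate-cong λ j → trans (VecP.lookup∘tabulate _ (ι j)) (cong (val β) (rep-eq j)))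
        (VecP.tabulate∘lookup β)
    ; from∘to  = λ {α} sα → trans
        (VecP.tabulate-cong λ v → val-restrict sα (pos v))
        (VecP.tabulate∘lookup α)
    }

  EquivLitElim-traceable : Traceable EquivLitElim-bijection
  EquivLitElim-traceable k ck _ with concrete-to (var k) ck
  ... | v , σv∼k , cv with ≡⊎≡negate k (σ v) (sym σv∼k)
  ...   | inj₁ refl = literalTrace (pos v) cv (λ sα → val-restrict sα (pos v))
  ...   | inj₂ refl = literalTrace (neg v) cv (λ sα → val-restrict sα (neg v))

  EquivLitElim-traceable⁻¹ : Traceable (ModelBijection-sym EquivLitElim-bijection)
  EquivLitElim-traceable⁻¹ k ck _ =
    literalTrace (substLit σ k) (concrete-from _ (var k) (var-substLit σ k) ck)
                 (λ {β} _ → sym (val-extend β k))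

  EquivLitElim⇒SamplingSafe : SamplingSafe φ ψ
  EquivLitElim⇒SamplingSafe = ModelBijection⇒SamplingSafe EquivLitElim-bijection
    EquivLitElim-traceable EquivLitElim-traceable⁻¹

theoremC1 : ∀ {n m} (φ : Formula n) (ψ : Formula m) → φ ⇝* ψ →
    ((Sφ : List (Assignment n)) → PairwiseSample φ Sφ →
       ∃ λ (Sψ : List (Assignment m)) → PairwiseSample ψ Sψ × length Sψ ≡ length Sφ)
    × ((Sψ : List (Assignment m)) → PairwiseSample ψ Sψ →
       ∃ λ (Sφ : List (Assignment n)) → PairwiseSample φ Sφ × length Sφ ≡ length Sψ)
theoremC1 φ .φ done = SamplingSafe-refl
theoremC1 φ ψ (fle step rest) =
  SamplingSafe-trans (FailedLitElim⇒SamplingSafe step) (theoremC1 _ ψ rest)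
theoremC1 φ ψ (ele step rest) =
  SamplingSafe-trans (EquivLitElim⇒SamplingSafe step) (theoremC1 _ ψ rest)
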